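{- Let $t \ge 3$ and $n \ge 3$ be integers. Then $M_t(C_n)$ is a distance magic graph if and only if $n = 4$.
   Context: $C_n$ is the cycle on $n$ vertices. For a graph $G=(V,E)$ and an integer $t \ge 1$, the generalised Mycielskian $M_t(G)$ is the graph with vertex set $(V \times \{0,1,\dots,t-1\}) \cup \{u\}$ (where $u$ is a new vertex), whose edges are: $(x,0)(y,0)$ for every edge $xy \in E$; $(x,i)(y,i+1)$ for every $0 \le i \le t-2$ and every ordered pair $(x,y)$ with $xy \in E$; and $(x,t-1)u$ for every $x \in V$. A graph $H$ on $N$ vertices is distance magic if there is a bijection $f: V(H) \to \{1,2,\dots,N\}$ and a constant $k$ such that for every vertex $v$, $\sum_{w \in N(v)} f(w) = k$, where $N(v)$ is the open neighbourhood of $v$. -}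

module Defs where

open import Data.Nat using (ℕ; _+_; _*_; _∸_; _%_)
open import Data.Fin using (Fin; toℕ; zero; suc)
open import Data.Fin.Properties using (+↔⊎; *↔×)
open import Data.Bool using (Bool; true; false; _∧_; _∨_; if_then_else_)
open import Data.Product using (_×_; _,_; ∃)
open import Data.Sum using (_⊎_; inj₁; inj₂)
open import Function.Bundles using (Inverse)
open import Function.Definitions using (Bijective)
open import Relation.Binary.PropositionalEquality using (_≡_)
open import Relation.Nullary.Decidable using (⌊_⌋)
import Data.Nat as ℕ

-- Well-formedness (symmetry, irreflexivity)
-- is recorded separately; the graphs below satisfy it by construction.
Graph : ℕ → Set
Graph N = Fin N → Fin N → Bool

sumFin : (N : ℕ) → (Fin N → ℕ) → ℕ
sumFin ℕ.zero    f = 0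
sumFin (ℕ.suc N) f = f zero + sumFin N (λ i → f (suc i))

_==_ : ℕ → ℕ → Bool
m == n = ⌊ m ℕ.≟ n ⌋

cycle : (n : ℕ) → Graph n
cycle ℕ.zero    i j = false
cycle (ℕ.suc m) i j =
  (toℕ j == ((toℕ i + 1) % ℕ.suc m)) ∨ (toℕ i == ((toℕ j + 1) % ℕ.suc m))

-- Vertices of M_t(G) for G on Fin n: Fin (n * t + 1), decoded as
-- (Fin n × Fin t) ⊎ Fin 1, where inj₂ _ is the extra vertex u.
decode : (n t : ℕ) → Fin (n * t + 1) → (Fin n × Fin t) ⊎ Fin 1
decode n t v with Inverse.to (+↔⊎ {n * t} {1}) v
... | inj₁ p = inj₁ (Inverse.to (*↔× {n} {t}) p)
... | inj₂ w = inj₂ w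

mycAdj : {n : ℕ} (t : ℕ) → Graph n →
         (Fin n × Fin t) ⊎ Fin 1 → (Fin n × Fin t) ⊎ Fin 1 → Bool
mycAdj t G (inj₁ (x , i)) (inj₁ (y , j)) =
  G x y ∧ (((toℕ i == 0) ∧ (toℕ j == 0))
           ∨ (toℕ j == ℕ.suc (toℕ i))
           ∨ (toℕ i == ℕ.suc (toℕ j)))
mycAdj t G (inj₁ (x , i)) (inj₂ _) = toℕ i == (t ∸ 1)
mycAdj t G (inj₂ _) (inj₁ (y , j)) = toℕ j == (t ∸ 1)
mycAdj t G (inj₂ _) (inj₂ _) = false

mycielskian : {n : ℕ} (t : ℕ) → Graph n → Graph (n * t + 1)
mycielskian {n} t G v w = mycAdj t G (decode n t v) (decode n t w)

-- Distance magic: a bijection f from vertices to labels {1,…,N}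
-- (label of v is toℕ (f v) + 1) and a constant k such that every
-- open-neighbourhood label sum equals k.
DistanceMagic : {N : ℕ} → Graph N → Set
DistanceMagic {N} H =
  ∃ λ (f : Fin N → Fin N) → Bijective _≡_ _≡_ f ×
    ∃ λ (k : ℕ) → ∀ (v : Fin N) →
      sumFin N (λ w → if H v w then ℕ.suc (toℕ (f w)) else 0) ≡ k

{-# OPTIONS --safe #-}
-- For n = 4, give the copies of the vertices 0, 1, 3, 2 of C₄ (in this order) consecutive blocks
-- of t labels, increasing with the level on 0 and 1 and decreasing on 2 and 3, and give the apex
-- 4t + 1.  Copies of antipodal vertices at a common level then have labels summing to 4t + 1; the
-- C₄-neighbours of any vertex form an antipodal pair; and every level has exactly two neighbouring
-- levels, counting the apex as the level above t − 1 and level 0 as its own neighbour.  Hence every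
-- neighbourhood sum is 2(4t + 1).
--
-- Conversely, the neighbourhood of a top vertex (x, t − 1) is the apex together with the
-- level-(t − 2) copies of the C_n-neighbours of x, so a distance magic labelling f makes the
-- injective labelling y ↦ f(y, t − 2) of C_n have constant neighbourhood sums.  Comparing the
-- vertices 0 and 1 of C₃, or 1 and 3 of C_n for n ≥ 5, forces two of these labels to coincide.
module Submission where

open import Defs
open import Data.Bool using (Bool; true; false; _∧_; _∨_; if_then_else_)
open import Data.Empty using (⊥-elim)
open import Data.Fin as Fin using (Fin; zero; suc; #_; toℕ; fromℕ; fromℕ<; inject₁; combine; _↑ˡ_; _↑ʳ_; opposite)
open import Data.Fin.Properties
  using (toℕ-injective; toℕ<n; toℕ-fromℕ; toℕ-fromℕ<; toℕ-inject₁; toℕ-↑ˡ; toℕ-↑ʳ; toℕ-combine;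
         ↑ˡ-injective; combine-injectiveˡ;
         splitAt-↑ˡ; splitAt-↑ʳ; join-splitAt; remQuot-combine; combine-remQuot;
         opposite-prop; opposite-involutive)
open import Data.Nat using (ℕ; zero; suc; _+_; _*_; _∸_; _%_; _≤_; _<_; _≥_; _≟_; z≤n; s≤s; s≤s⁻¹)
open import Data.Nat.Properties
open import Algebra.Properties.CommutativeSemigroup +-commutativeSemigroup using (interchange)
open import Data.Nat.DivMod using (m<n⇒m%n≡m; n%n≡0)
open import Data.Nat.Tactic.RingSolver using (solve-∀)
open import Data.Product using (_×_; _,_; Σ)
open import Data.Sum using (_⊎_; inj₁; inj₂)
open import Function using (_∘_)
open import Function.Bundles using (_⇔_; mk⇔; mk↔ₛ′; Bijection)
open import Function.Definitions using (Injective; Bijective)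
open import Function.Properties.Inverse using (↔⇒⤖)
open import Relation.Binary.PropositionalEquality
open import Relation.Nullary using (¬_; yes; no)
open import Relation.Nullary.Decidable using (isYes≗does; dec-true; dec-false)

open ≡-Reasoning

==-refl : ∀ n → (n == n) ≡ true
==-refl n = trans (isYes≗does (n ≟ n)) (dec-true (n ≟ n) refl)

==-≢ : ∀ {m n} → m ≢ n → (m == n) ≡ false
==-≢ {m} {n} m≢n = trans (isYes≗does (m ≟ n)) (dec-false (m ≟ n) m≢n)

==-suc : ∀ m n → (suc m == suc n) ≡ (m == n)
==-suc m n with m ≟ n
... | yes refl = ==-refl (suc m)
... | no m≢n = ==-≢ (m≢n ∘ suc-injective)

==-sym : ∀ m n → (m == n) ≡ (n == m)
==-sym m n with m ≟ n
... | yes refl = sym (==-refl m)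
... | no m≢n = sym (==-≢ (m≢n ∘ sym))

==-∧-≢ : ∀ j {a b} → a ≢ b → ((j == a) ∧ (j == b)) ≡ false
==-∧-≢ j {a} a≢b with j ≟ a
... | yes refl = ==-≢ a≢b
... | no _ = refl

if-cong : ∀ {b c v} → b ≡ c → (if b then v else 0) ≡ (if c then v else 0)
if-cong refl = refl

if-∨ : ∀ p q v → (p ∧ q) ≡ false →
       (if p ∨ q then v else 0) ≡ (if p then v else 0) + (if q then v else 0)
if-∨ true  false v _ = sym (+-identityʳ v)
if-∨ false q     v _ = refl

if-+ : ∀ b u v → (if b then u + v else 0) ≡ (if b then u else 0) + (if b then v else 0)
if-+ true  u v = refl
if-+ false u v = refl

sumFin-cong : ∀ N {f g : Fin N → ℕ} → (∀ i → f i ≡ g i) → sumFin N f ≡ sumFin N g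
sumFin-cong zero    f≗g = refl
sumFin-cong (suc N) f≗g = cong₂ _+_ (f≗g zero) (sumFin-cong N (λ i → f≗g (suc i)))

sumFin-zero : ∀ N → sumFin N (λ _ → 0) ≡ 0
sumFin-zero zero    = refl
sumFin-zero (suc N) = sumFin-zero N

sumFin-+ : ∀ N (f g : Fin N → ℕ) →
           sumFin N (λ i → f i + g i) ≡ sumFin N f + sumFin N g
sumFin-+ zero    f g = refl
sumFin-+ (suc N) f g =
  trans (cong (f zero + g zero +_) (sumFin-+ N (λ i → f (suc i)) (λ i → g (suc i))))
        (interchange (f zero) (g zero) _ _)

sumFin-↑ : ∀ a b (g : Fin (a + b) → ℕ) →
           sumFin (a + b) g ≡ sumFin a (λ i → g (i ↑ˡ b)) + sumFin b (λ j → g (a ↑ʳ j))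
sumFin-↑ zero    b g = refl
sumFin-↑ (suc a) b g =
  trans (cong (g zero +_) (sumFin-↑ a b (λ i → g (suc i)))) (sym (+-assoc (g zero) _ _))

sumFin-combine : ∀ n t (g : Fin (n * t) → ℕ) →
                 sumFin (n * t) g ≡ sumFin n (λ x → sumFin t (λ i → g (combine x i)))
sumFin-combine zero    t g = refl
sumFin-combine (suc n) t g =
  trans (sumFin-↑ t (n * t) g)
        (cong (sumFin t (λ i → g (i ↑ˡ (n * t))) +_) (sumFin-combine n t (λ j → g (t ↑ʳ j))))

sumFin-if-∨ : ∀ N (p q : Fin N → Bool) (g : Fin N → ℕ) → (∀ i → (p i ∧ q i) ≡ false) →
              sumFin N (λ i → if p i ∨ q i then g i else 0)
              ≡ sumFin N (λ i → if p i then g i else 0) + sumFin N (λ i → if q i then g i else 0)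
sumFin-if-∨ N p q g disjoint =
  trans (sumFin-cong N (λ i → if-∨ (p i) (q i) (g i) (disjoint i))) (sumFin-+ N _ _)

sumFin-if-∧ : ∀ N b (c : Fin N → Bool) (g : Fin N → ℕ) →
              sumFin N (λ i → if b ∧ c i then g i else 0)
              ≡ (if b then sumFin N (λ i → if c i then g i else 0) else 0)
sumFin-if-∧ N true  c g = refl
sumFin-if-∧ N false c g = sumFin-zero N

valueAt : ∀ t → (Fin t → ℕ) → ℕ → ℕ
valueAt t g a = sumFin t (λ i → if toℕ i == a then g i else 0)

valueAt-toℕ : ∀ t (g : Fin t → ℕ) j → valueAt t g (toℕ j) ≡ g j
valueAt-toℕ (suc t) g zero    = trans (cong (g zero +_) (sumFin-zero t)) (+-identityʳ _)
valueAt-toℕ (suc t) g (suc j) =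
  trans (sumFin-cong t (λ i → if-cong (==-suc (toℕ i) (toℕ j))))
        (valueAt-toℕ t (λ i → g (suc i)) j)

valueAt-< : ∀ t (g : Fin t → ℕ) a (a<t : a < t) → valueAt t g a ≡ g (fromℕ< a<t)
valueAt-< t g a a<t = subst (λ b → valueAt t g b ≡ g (fromℕ< a<t)) (toℕ-fromℕ< a<t)
                            (valueAt-toℕ t g (fromℕ< a<t))

valueAt-≥ : ∀ t (g : Fin t → ℕ) a → t ≤ a → valueAt t g a ≡ 0
valueAt-≥ zero    g a       _        = refl
valueAt-≥ (suc t) g (suc a) (s≤s t≤a) =
  trans (sumFin-cong t (λ i → if-cong (==-suc (toℕ i) a)))
        (valueAt-≥ t (λ i → g (suc i)) a t≤a)

nbrSum : ∀ {N} → Graph N → (Fin N → ℕ) → Fin N → ℕ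
nbrSum {N} H ℓ v = sumFin N (λ w → if H v w then ℓ w else 0)

nbrSum-cong : ∀ {n} (G : Graph n) {g h : Fin n → ℕ} → (∀ y → g y ≡ h y) → ∀ x → nbrSum G g x ≡ nbrSum G h x
nbrSum-cong {n} G g≗h x = sumFin-cong n (λ y → cong (λ v → if G x y then v else 0) (g≗h y))

levelAdj : ℕ → ℕ → Bool
levelAdj a j = ((a == 0) ∧ (j == 0)) ∨ (j == suc a) ∨ (a == suc j)

levelSum : ∀ t → ℕ → (Fin t → ℕ) → ℕ
levelSum t a g = sumFin t (λ j → if levelAdj a (toℕ j) then g j else 0)

levelSum-cong : ∀ t a {g h : Fin t → ℕ} → (∀ j → g j ≡ h j) → levelSum t a g ≡ levelSum t a h
levelSum-cong t a g≗h = sumFin-cong t (λ j → cong (λ v → if levelAdj a (toℕ j) then v else 0) (g≗h j))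

levelSum-+ : ∀ t a (g h : Fin t → ℕ) →
             levelSum t a g + levelSum t a h ≡ levelSum t a (λ j → g j + h j)
levelSum-+ t a g h =
  sym (trans (sumFin-cong t (λ j → if-+ (levelAdj a (toℕ j)) (g j) (h j))) (sumFin-+ t _ _))

levelSum-split : ∀ t a b c (g : Fin t → ℕ) → (∀ j → levelAdj a j ≡ (j == b) ∨ (j == c)) → b ≢ c →
               levelSum t a g ≡ valueAt t g b + valueAt t g c
levelSum-split t a b c g adj b≢c =
  trans (sumFin-cong t (λ j → if-cong (adj (toℕ j))))
        (sumFin-if-∨ t _ _ g (λ j → ==-∧-≢ (toℕ j) b≢c))

levelSum-zero : ∀ t (g : Fin t → ℕ) → levelSum t 0 g ≡ valueAt t g 0 + valueAt t g 1
levelSum-zero t g = levelSum-split t 0 0 1 g adj (λ ())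
  where
  adj : ∀ j → levelAdj 0 j ≡ (j == 0) ∨ (j == 1)
  adj zero          = refl
  adj (suc zero)    = refl
  adj (suc (suc j)) = refl

levelSum-suc : ∀ t a (g : Fin t → ℕ) →
               levelSum t (suc a) g ≡ valueAt t g (suc (suc a)) + valueAt t g a
levelSum-suc t a g = levelSum-split t (suc a) (suc (suc a)) a g adj (>⇒≢ (m<n⇒m<1+n (n<1+n a)))
  where
  adj : ∀ j → levelAdj (suc a) j ≡ (j == suc (suc a)) ∨ (j == a)
  adj j rewrite ==-suc a j | ==-sym a j = refl

levelSum-const : ∀ t a U → 2 ≤ t → a < t →
                 levelSum t a (λ _ → U) + (if a == (t ∸ 1) then U else 0) ≡ U + U
levelSum-const (suc t) zero U (s≤s 0<t) _ = begin
  levelSum (suc t) 0 (λ _ → U) + (if 0 == t then U else 0)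
    ≡⟨ cong (levelSum (suc t) 0 (λ _ → U) +_) (if-cong (==-≢ (<⇒≢ 0<t))) ⟩
  levelSum (suc t) 0 (λ _ → U) + 0
    ≡⟨ +-identityʳ _ ⟩
  levelSum (suc t) 0 (λ _ → U)
    ≡⟨ levelSum-zero (suc t) (λ _ → U) ⟩
  valueAt (suc t) (λ _ → U) 0 + valueAt (suc t) (λ _ → U) 1
    ≡⟨ cong₂ _+_ (valueAt-< (suc t) (λ _ → U) 0 (s≤s z≤n))
                 (valueAt-< (suc t) (λ _ → U) 1 (s≤s 0<t)) ⟩
  U + U ∎
levelSum-const (suc t) (suc b) U _ (s≤s b<t) with suc b ≟ t
... | yes refl = cong (_+ U) (begin
  levelSum (suc (suc b)) (suc b) (λ _ → U)
    ≡⟨ levelSum-suc (suc (suc b)) b (λ _ → U) ⟩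
  valueAt (suc (suc b)) (λ _ → U) (suc (suc b)) + valueAt (suc (suc b)) (λ _ → U) b
    ≡⟨ cong₂ _+_ (valueAt-≥ (suc (suc b)) (λ _ → U) _ ≤-refl)
                 (valueAt-< (suc (suc b)) (λ _ → U) b (m<n⇒m<1+n (n<1+n b))) ⟩
  U ∎)
... | no b+1≢t = begin
  levelSum (suc t) (suc b) (λ _ → U) + 0
    ≡⟨ +-identityʳ _ ⟩
  levelSum (suc t) (suc b) (λ _ → U)
    ≡⟨ levelSum-suc (suc t) b (λ _ → U) ⟩
  valueAt (suc t) (λ _ → U) (suc (suc b)) + valueAt (suc t) (λ _ → U) b
    ≡⟨ cong₂ _+_ (valueAt-< (suc t) (λ _ → U) _ (s≤s (≤∧≢⇒< b<t b+1≢t)))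
                 (valueAt-< (suc t) (λ _ → U) b (m<n⇒m<1+n b<t)) ⟩
  U + U ∎

levelSum-last : ∀ s (g : Fin (suc (suc s)) → ℕ) →
                levelSum (suc (suc s)) (suc s) g ≡ g (inject₁ (fromℕ s))
levelSum-last s g = begin
  levelSum (suc (suc s)) (suc s) g
    ≡⟨ levelSum-suc _ s g ⟩
  valueAt _ g (suc (suc s)) + valueAt _ g s
    ≡⟨ cong₂ _+_ (valueAt-≥ _ g _ ≤-refl) (cong (valueAt _ g) (sym toℕ-penultimate)) ⟩
  valueAt _ g (toℕ (inject₁ (fromℕ s)))
    ≡⟨ valueAt-toℕ _ g _ ⟩
  g (inject₁ (fromℕ s)) ∎
  where
  toℕ-penultimate : toℕ (inject₁ (fromℕ s)) ≡ s
  toℕ-penultimate = trans (toℕ-inject₁ (fromℕ s)) (toℕ-fromℕ s)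

vertex : ∀ {n t} → Fin n → Fin t → Fin (n * t + 1)
vertex x i = combine x i ↑ˡ 1

apex : ∀ n t → Fin (n * t + 1)
apex n t = (n * t) ↑ʳ zero

encode : ∀ {n t} → (Fin n × Fin t) ⊎ Fin 1 → Fin (n * t + 1)
encode (inj₁ (x , i))      = vertex x i
encode {n} {t} (inj₂ zero) = apex n t

decode-vertex : ∀ n t (x : Fin n) (i : Fin t) → decode n t (vertex x i) ≡ inj₁ (x , i)
decode-vertex n t x i rewrite splitAt-↑ˡ (n * t) (combine x i) 1 | remQuot-combine {n} {t} x i = refl

decode-apex : ∀ n t → decode n t (apex n t) ≡ inj₂ zero
decode-apex n t rewrite splitAt-↑ʳ (n * t) 1 zero = refl

decode-encode : ∀ n t d → decode n t (encode d) ≡ d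
decode-encode n t (inj₁ (x , i)) = decode-vertex n t x i
decode-encode n t (inj₂ zero)    = decode-apex n t

encode-decode : ∀ n t w → encode (decode n t w) ≡ w
encode-decode n t w with Fin.splitAt (n * t) {1} w in eq
... | inj₁ p    = trans (cong (_↑ˡ 1) (combine-remQuot {n} t p)) (join-inverse eq)
  where
  join-inverse : ∀ {d} → Fin.splitAt (n * t) w ≡ d → Fin.join (n * t) 1 d ≡ w
  join-inverse refl = join-splitAt (n * t) 1 w
... | inj₂ zero = trans (sym (cong (Fin.join (n * t) 1) eq)) (join-splitAt (n * t) 1 w)

vertex-injectiveˡ : ∀ {n t} (x y : Fin n) (i : Fin t) → vertex x i ≡ vertex y i → x ≡ y
vertex-injectiveˡ x y i e = combine-injectiveˡ x i y i (↑ˡ-injective 1 _ _ e)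

sumFin-vertices : ∀ n t (g : Fin (n * t + 1) → ℕ) →
  sumFin (n * t + 1) g ≡ sumFin n (λ x → sumFin t (λ i → g (vertex x i))) + g (apex n t)
sumFin-vertices n t g =
  trans (sumFin-↑ (n * t) 1 g)
        (cong₂ _+_ (sumFin-combine n t (λ j → g (j ↑ˡ 1))) (+-identityʳ (g (apex n t))))

module _ {n : ℕ} (t : ℕ) (G : Graph n) where

  mycielskian-vertex-vertex : ∀ x i y j →
    mycielskian t G (vertex x i) (vertex y j) ≡ G x y ∧ levelAdj (toℕ i) (toℕ j)
  mycielskian-vertex-vertex x i y j rewrite decode-vertex n t x i | decode-vertex n t y j = refl

  mycielskian-vertex-apex : ∀ x i → mycielskian t G (vertex x i) (apex n t) ≡ (toℕ i == (t ∸ 1))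
  mycielskian-vertex-apex x i rewrite decode-vertex n t x i | decode-apex n t = refl

  mycielskian-apex-vertex : ∀ y j → mycielskian t G (apex n t) (vertex y j) ≡ (toℕ j == (t ∸ 1))
  mycielskian-apex-vertex y j rewrite decode-vertex n t y j | decode-apex n t = refl

  mycielskian-apex-apex : mycielskian t G (apex n t) (apex n t) ≡ false
  mycielskian-apex-apex rewrite decode-apex n t = refl

nbrSum-vertex : ∀ {n} t (G : Graph n) (ℓ : Fin (n * t + 1) → ℕ) x k →
  nbrSum (mycielskian t G) ℓ (vertex x k)
  ≡ nbrSum G (λ y → levelSum t (toℕ k) (λ i → ℓ (vertex y i))) x
    + (if toℕ k == (t ∸ 1) then ℓ (apex n t) else 0)
nbrSum-vertex {n} t G ℓ x k =
  trans (sumFin-vertices n t _)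
        (cong₂ _+_ (sumFin-cong n (λ y → trans (sumFin-cong t (λ i →
                                                   if-cong (mycielskian-vertex-vertex t G x k y i)))
                                               (sumFin-if-∧ t (G x y) _ _)))
                   (if-cong (mycielskian-vertex-apex t G x k)))

nbrSum-apex : ∀ {n} t (G : Graph n) (ℓ : Fin (n * t + 1) → ℕ) →
  nbrSum (mycielskian t G) ℓ (apex n t) ≡ sumFin n (λ y → valueAt t (λ i → ℓ (vertex y i)) (t ∸ 1))
nbrSum-apex {n} t G ℓ =
  trans (sumFin-vertices n t _)
        (trans (cong₂ _+_ (sumFin-cong n (λ y → sumFin-cong t (λ i →
                                     if-cong (mycielskian-apex-vertex t G y i))))
                          (if-cong (mycielskian-apex-apex t G)))
               (+-identityʳ _))

C₄-nbrSum : ∀ (h : Fin 4 → ℕ) {c} →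
  h (# 0) + h (# 2) ≡ c → h (# 1) + h (# 3) ≡ c →
  ∀ x → nbrSum (cycle 4) h x ≡ c
C₄-nbrSum h h₀+h₂ h₁+h₃ zero                   = trans (cong (h (# 1) +_) (+-identityʳ _)) h₁+h₃
C₄-nbrSum h h₀+h₂ h₁+h₃ (suc zero)             = trans (cong (h (# 0) +_) (+-identityʳ _)) h₀+h₂
C₄-nbrSum h h₀+h₂ h₁+h₃ (suc (suc zero))       = trans (cong (h (# 1) +_) (+-identityʳ _)) h₁+h₃
C₄-nbrSum h h₀+h₂ h₁+h₃ (suc (suc (suc zero))) = trans (cong (h (# 0) +_) (+-identityʳ _)) h₀+h₂

C₄-sumFin : ∀ (h : Fin 4 → ℕ) {c} →
  h (# 0) + h (# 2) ≡ c → h (# 1) + h (# 3) ≡ c →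
  sumFin 4 h ≡ c + c
C₄-sumFin h h₀+h₂ h₁+h₃ =
  trans (regroup (h (# 0)) (h (# 1)) (h (# 2)) (h (# 3)))
        (cong₂ _+_ h₀+h₂ h₁+h₃)
  where
  regroup : ∀ a b c d → a + (b + (c + (d + 0))) ≡ (a + c) + (b + d)
  regroup = solve-∀

labelBlock : Fin 4 → Fin 4
labelBlock zero                   = zero
labelBlock (suc zero)             = suc zero
labelBlock (suc (suc zero))       = suc (suc (suc zero))
labelBlock (suc (suc (suc zero))) = suc (suc zero)

labelOffset : ∀ {t} → Fin 4 → Fin t → Fin t
labelOffset zero                   i = i
labelOffset (suc zero)             i = i
labelOffset (suc (suc zero))       i = opposite i
labelOffset (suc (suc (suc zero))) i = opposite i

relabel : ∀ {t} → (Fin 4 × Fin t) ⊎ Fin 1 → (Fin 4 × Fin t) ⊎ Fin 1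
relabel (inj₁ (x , i)) = inj₁ (labelBlock x , labelOffset x i)
relabel (inj₂ z)       = inj₂ z

relabel-involutive : ∀ {t} (d : (Fin 4 × Fin t) ⊎ Fin 1) → relabel (relabel d) ≡ d
relabel-involutive (inj₁ (zero , i))                 = refl
relabel-involutive (inj₁ (suc zero , i))             = refl
relabel-involutive (inj₁ (suc (suc zero) , i))       = cong (λ j → inj₁ (_ , j)) (opposite-involutive i)
relabel-involutive (inj₁ (suc (suc (suc zero)) , i)) = cong (λ j → inj₁ (_ , j)) (opposite-involutive i)
relabel-involutive (inj₂ z)                          = refl

toℕ-vertex : ∀ {n t} (x : Fin n) (i : Fin t) → toℕ (vertex x i) ≡ t * toℕ x + toℕ i
toℕ-vertex x i = trans (toℕ-↑ˡ (combine x i) 1) (toℕ-combine x i)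

toℕ-opposite-sum : ∀ {t} (i : Fin t) → suc (toℕ i + toℕ (opposite i)) ≡ t
toℕ-opposite-sum i = trans (cong (suc (toℕ i) +_) (opposite-prop i)) (m+[n∸m]≡n (toℕ<n i))

label-sum-opposite : ∀ {t} c c' (i : Fin t) → c + c' ≡ 3 →
  suc (t * c + toℕ i) + suc (t * c' + toℕ (opposite i)) ≡ suc (4 * t)
label-sum-opposite {t} c c' i c+c'≡3 = begin
  suc (t * c + toℕ i) + suc (t * c' + toℕ (opposite i))
    ≡⟨ regroup t c c' (toℕ i) (toℕ (opposite i)) ⟩
  suc (t * (c + c') + suc (toℕ i + toℕ (opposite i)))
    ≡⟨ cong₂ (λ m k → suc (t * m + k)) c+c'≡3 (toℕ-opposite-sum i) ⟩
  suc (t * 3 + t)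
    ≡⟨ cong suc (t*3+t≡4*t t) ⟩
  suc (4 * t) ∎
  where
  regroup : ∀ t c c' a b → suc (t * c + a) + suc (t * c' + b) ≡ suc (t * (c + c') + suc (a + b))
  regroup = solve-∀
  t*3+t≡4*t : ∀ t → t * 3 + t ≡ 4 * t
  t*3+t≡4*t = solve-∀

module _ (t : ℕ) where

  vertex₄ : Fin 4 → Fin t → Fin (4 * t + 1)
  vertex₄ = vertex

  C₄-labelling : Fin (4 * t + 1) → Fin (4 * t + 1)
  C₄-labelling = encode ∘ relabel ∘ decode 4 t

  C₄-labelling-involutive : ∀ w → C₄-labelling (C₄-labelling w) ≡ w
  C₄-labelling-involutive w = begin
    C₄-labelling (C₄-labelling w)
      ≡⟨ cong (encode ∘ relabel) (decode-encode 4 t (relabel (decode 4 t w))) ⟩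
    encode (relabel (relabel (decode 4 t w)))
      ≡⟨ cong encode (relabel-involutive (decode 4 t w)) ⟩
    encode (decode 4 t w)
      ≡⟨ encode-decode 4 t w ⟩
    w ∎

  C₄-labelling-bijective : Bijective _≡_ _≡_ C₄-labelling
  C₄-labelling-bijective =
    Bijection.bijective (↔⇒⤖ (mk↔ₛ′ C₄-labelling C₄-labelling
                                    C₄-labelling-involutive C₄-labelling-involutive))

  C₄-label : Fin (4 * t + 1) → ℕ
  C₄-label w = suc (toℕ (C₄-labelling w))

  C₄-label-vertex : ∀ x i →
    C₄-label (vertex₄ x i) ≡ suc (t * toℕ (labelBlock x) + toℕ (labelOffset x i))
  C₄-label-vertex x i rewrite decode-vertex 4 t x i =
    cong suc (toℕ-vertex (labelBlock x) (labelOffset x i))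

  C₄-label-apex : C₄-label (apex 4 t) ≡ suc (4 * t)
  C₄-label-apex rewrite decode-apex 4 t = cong suc (trans (toℕ-↑ʳ (4 * t) zero) (+-identityʳ _))

  C₄-antipodal₀₂ : ∀ i →
    C₄-label (vertex₄ (# 0) i) + C₄-label (vertex₄ (# 2) i) ≡ C₄-label (apex 4 t)
  C₄-antipodal₀₂ i =
    trans (cong₂ _+_ (C₄-label-vertex (# 0) i) (C₄-label-vertex (# 2) i))
          (trans (label-sum-opposite 0 3 i refl) (sym C₄-label-apex))

  C₄-antipodal₁₃ : ∀ i →
    C₄-label (vertex₄ (# 1) i) + C₄-label (vertex₄ (# 3) i) ≡ C₄-label (apex 4 t)
  C₄-antipodal₁₃ i =
    trans (cong₂ _+_ (C₄-label-vertex (# 1) i) (C₄-label-vertex (# 3) i))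
          (trans (label-sum-opposite 1 2 i refl) (sym C₄-label-apex))

  C₄-levelSum-pair : ∀ a y y' →
    (∀ i → C₄-label (vertex₄ y i) + C₄-label (vertex₄ y' i) ≡ C₄-label (apex 4 t)) →
    levelSum t a (C₄-label ∘ vertex₄ y) + levelSum t a (C₄-label ∘ vertex₄ y')
    ≡ levelSum t a (λ _ → C₄-label (apex 4 t))
  C₄-levelSum-pair a y y' antipodal = trans (levelSum-+ t a _ _) (levelSum-cong t a antipodal)

  C₄-distanceMagic : 2 ≤ t → DistanceMagic (mycielskian t (cycle 4))
  C₄-distanceMagic 2≤t = C₄-labelling , C₄-labelling-bijective , U + U , nbrSum-constant
    where
    U : ℕ
    U = C₄-label (apex 4 t)

    top<t : t ∸ 1 < t
    top<t = ∸-monoʳ-< (s≤s z≤n) (≤-trans (n≤1+n 1) 2≤t)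

    top : Fin t
    top = fromℕ< top<t

    nbrSum-encode : ∀ d → nbrSum (mycielskian t (cycle 4)) C₄-label (encode d) ≡ U + U
    nbrSum-encode (inj₁ (x , k)) = begin
      nbrSum (mycielskian t (cycle 4)) C₄-label (vertex x k)
        ≡⟨ nbrSum-vertex t (cycle 4) C₄-label x k ⟩
      nbrSum (cycle 4) (λ y → levelSum t (toℕ k) (C₄-label ∘ vertex₄ y)) x + apexTerm
        ≡⟨ cong (_+ apexTerm) (C₄-nbrSum (λ y → levelSum t (toℕ k) (C₄-label ∘ vertex₄ y))
                                           (C₄-levelSum-pair (toℕ k) (# 0) (# 2) C₄-antipodal₀₂)
                                           (C₄-levelSum-pair (toℕ k) (# 1) (# 3) C₄-antipodal₁₃) x) ⟩
      levelSum t (toℕ k) (λ _ → U) + apexTerm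
        ≡⟨ levelSum-const t (toℕ k) U 2≤t (toℕ<n k) ⟩
      U + U ∎
      where
      apexTerm : ℕ
      apexTerm = if toℕ k == (t ∸ 1) then U else 0
    nbrSum-encode (inj₂ zero) = begin
      nbrSum (mycielskian t (cycle 4)) C₄-label (apex 4 t)
        ≡⟨ nbrSum-apex t (cycle 4) C₄-label ⟩
      sumFin 4 (λ y → valueAt t (C₄-label ∘ vertex₄ y) (t ∸ 1))
        ≡⟨ sumFin-cong 4 (λ y → valueAt-< t (C₄-label ∘ vertex₄ y) (t ∸ 1) top<t) ⟩
      sumFin 4 (λ y → C₄-label (vertex₄ y top))
        ≡⟨ C₄-sumFin (λ y → C₄-label (vertex₄ y top)) (C₄-antipodal₀₂ top) (C₄-antipodal₁₃ top) ⟩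
      U + U ∎

    nbrSum-constant : ∀ w → nbrSum (mycielskian t (cycle 4)) C₄-label w ≡ U + U
    nbrSum-constant w = subst (λ v → nbrSum (mycielskian t (cycle 4)) C₄-label v ≡ U + U)
                              (encode-decode 4 t w) (nbrSum-encode (decode 4 t w))

ConstantNbrSumLabelling : ∀ {n} → Graph n → Set
ConstantNbrSumLabelling {n} G =
  Σ (Fin n → ℕ) λ h → Injective _≡_ _≡_ h × (∀ x x' → nbrSum G h x ≡ nbrSum G h x')

distanceMagic⇒constantNbrSumLabelling : ∀ t {n} (G : Graph n) → 2 ≤ t →
  DistanceMagic (mycielskian t G) → ConstantNbrSumLabelling G
distanceMagic⇒constantNbrSumLabelling (suc (suc s)) {n} G (s≤s (s≤s _))
                                      (f , (f-injective , _) , K , magic) =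
  h , h-injective , λ x x' → +-cancelʳ-≡ (ℓ u) _ _ (trans (top-vertex x) (sym (top-vertex x')))
  where
  t : ℕ
  t = suc (suc s)

  u : Fin (n * t + 1)
  u = apex n t

  ℓ : Fin (n * t + 1) → ℕ
  ℓ w = suc (toℕ (f w))

  h : Fin n → ℕ
  h y = ℓ (vertex y (inject₁ (fromℕ s)))

  h-injective : Injective _≡_ _≡_ h
  h-injective {y} {y'} e = vertex-injectiveˡ y y' _ (f-injective (toℕ-injective (suc-injective e)))

  top-vertex : ∀ x → nbrSum G h x + ℓ u ≡ K
  top-vertex x = begin
    nbrSum G h x + ℓ u
      ≡⟨ cong₂ _+_ (nbrSum-cong G (λ y → sym (levelSum-last s (ℓ ∘ vertex y))) x)
                   (sym (if-cong (==-refl (suc s)))) ⟩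
    nbrSum G (λ y → levelSum t (suc s) (ℓ ∘ vertex y)) x + (if suc s == suc s then ℓ u else 0)
      ≡⟨ cong (λ a → nbrSum G (λ y → levelSum t a (ℓ ∘ vertex y)) x + (if a == suc s then ℓ u else 0))
              (sym (toℕ-fromℕ (suc s))) ⟩
    nbrSum G (λ y → levelSum t (toℕ (fromℕ (suc s))) (ℓ ∘ vertex y)) x
      + (if toℕ (fromℕ (suc s)) == suc s then ℓ u else 0)
      ≡⟨ sym (nbrSum-vertex t G ℓ x (fromℕ (suc s))) ⟩
    nbrSum (mycielskian t G) ℓ (vertex x (fromℕ (suc s)))
      ≡⟨ magic (vertex x (fromℕ (suc s))) ⟩
    K ∎

C₃-¬constantNbrSumLabelling : ¬ ConstantNbrSumLabelling (cycle 3)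
C₃-¬constantNbrSumLabelling (h , h-injective , constant)
  with h-injective (+-cancelʳ-≡ (h (# 2) + 0) _ _ (constant (# 0) (# 1)))
... | ()

==-[1+j]% : ∀ m b j → suc b < suc m → j < suc m → (suc b == ((j + 1) % suc m)) ≡ (j == b)
==-[1+j]% m b j b+1<n j<n with m≤n⇒m<n∨m≡n j<n
... | inj₁ j+1<n = begin
  suc b == ((j + 1) % suc m)  ≡⟨ cong (λ k → suc b == (k % suc m)) (+-comm j 1) ⟩
  suc b == (suc j % suc m)    ≡⟨ cong (suc b ==_) (m<n⇒m%n≡m j+1<n) ⟩
  suc b == suc j              ≡⟨ ==-suc b j ⟩
  b == j                      ≡⟨ ==-sym b j ⟩
  j == b                      ∎
... | inj₂ j+1≡n = begin
  suc b == ((j + 1) % suc m)  ≡⟨ cong (λ k → suc b == (k % suc m)) (trans (+-comm j 1) j+1≡n) ⟩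
  suc b == (suc m % suc m)    ≡⟨ cong (suc b ==_) (n%n≡0 (suc m)) ⟩
  false                       ≡⟨ ==-≢ (>⇒≢ (subst (b <_) (suc-injective (sym j+1≡n)) (s≤s⁻¹ b+1<n))) ⟨
  j == b                      ∎

cycle-interior : ∀ m (x y : Fin (suc m)) b → toℕ x ≡ suc b → suc (suc b) < suc m →
  cycle (suc m) x y ≡ (toℕ y == suc (suc b)) ∨ (toℕ y == b)
cycle-interior m x y b x≡1+b b+2<n
  rewrite x≡1+b | +-comm (suc b) 1 | m<n⇒m%n≡m b+2<n
        | ==-[1+j]% m b (toℕ y) (<-trans (n<1+n (suc b)) b+2<n) (toℕ<n y) = refl

nbrSum-cycle-interior : ∀ m (h : Fin (suc m) → ℕ) x b → toℕ x ≡ suc b → suc (suc b) < suc m →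
  nbrSum (cycle (suc m)) h x ≡ valueAt (suc m) h (suc (suc b)) + valueAt (suc m) h b
nbrSum-cycle-interior m h x b x≡1+b b+2<n =
  trans (sumFin-cong (suc m) (λ y → if-cong {v = h y} (cycle-interior m x y b x≡1+b b+2<n)))
        (sumFin-if-∨ (suc m) (λ y → toℕ y == suc (suc b)) (λ y → toℕ y == b) h
                     (λ y → ==-∧-≢ (toℕ y) (>⇒≢ (m<n⇒m<1+n (n<1+n b)))))

C₅₊-¬constantNbrSumLabelling : ∀ r → ¬ ConstantNbrSumLabelling (cycle (5 + r))
C₅₊-¬constantNbrSumLabelling r (h , h-injective , constant) with h-injective h₀≡h₄
  where
  h₀≡h₄ : h (# 0) ≡ h (# 4)
  h₀≡h₄ = +-cancelˡ-≡ (h (# 2)) _ _ (begin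
    h (# 2) + h (# 0)
      ≡⟨ cong₂ _+_ (valueAt-toℕ (5 + r) h (# 2)) (valueAt-toℕ (5 + r) h (# 0)) ⟨
    valueAt (5 + r) h 2 + valueAt (5 + r) h 0
      ≡⟨ nbrSum-cycle-interior (4 + r) h (# 1) 0 refl (s≤s (s≤s (s≤s z≤n))) ⟨
    nbrSum (cycle (5 + r)) h (# 1)
      ≡⟨ constant (# 1) (# 3) ⟩
    nbrSum (cycle (5 + r)) h (# 3)
      ≡⟨ nbrSum-cycle-interior (4 + r) h (# 3) 2 refl (s≤s (s≤s (s≤s (s≤s (s≤s z≤n))))) ⟩
    valueAt (5 + r) h 4 + valueAt (5 + r) h 2
      ≡⟨ cong₂ _+_ (valueAt-toℕ (5 + r) h (# 4)) (valueAt-toℕ (5 + r) h (# 2)) ⟩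
    h (# 4) + h (# 2)
      ≡⟨ +-comm (h (# 4)) (h (# 2)) ⟩
    h (# 2) + h (# 4) ∎)
... | ()

cycle-constantNbrSumLabelling⇒≡4 : ∀ n → n ≥ 3 → ConstantNbrSumLabelling (cycle n) → n ≡ 4
cycle-constantNbrSumLabelling⇒≡4 1 (s≤s ()) _
cycle-constantNbrSumLabelling⇒≡4 2 (s≤s (s≤s ())) _
cycle-constantNbrSumLabelling⇒≡4 3 _ labelling = ⊥-elim (C₃-¬constantNbrSumLabelling labelling)
cycle-constantNbrSumLabelling⇒≡4 4 _ _ = refl
cycle-constantNbrSumLabelling⇒≡4 (suc (suc (suc (suc (suc r))))) _ labelling =
  ⊥-elim (C₅₊-¬constantNbrSumLabelling r labelling)

theorem2p8 : (t n : ℕ) → t ≥ 3 → n ≥ 3 →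
    DistanceMagic (mycielskian t (cycle n)) ⇔ (n ≡ 4)
theorem2p8 t n t≥3 n≥3 = mk⇔
  (λ magic → cycle-constantNbrSumLabelling⇒≡4 n n≥3
               (distanceMagic⇒constantNbrSumLabelling t (cycle n) t≥2 magic))
  (λ { refl → C₄-distanceMagic t t≥2 })
  where
  t≥2 : t ≥ 2
  t≥2 = ≤-trans (n≤1+n 2) t≥3
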